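{- Let $\mathcal D$ be a $(v,k,\lambda)$ design with replication number $r$, and let $\mathcal L$ be its Levi graph. Then the harmonious chromatic number of $\mathcal L$ satisfies $h(\mathcal L)\ge r+\frac{v+1}{2}$.
   Context: A $(v,k,\lambda)$ design (2-design) is a pair $(V,\mathcal B)$ with $V$ a set of $v$ points and $\mathcal B$ a collection of $k$-subsets of $V$ (blocks), $v\ge k\ge3$, such that every pair of distinct points lies in exactly $\lambda$ blocks; every point then lies in the same number $r$ of blocks (the replication number). Its Levi graph is the bipartite graph whose vertices are the points and the blocks, a point adjacent to a block iff it lies in it. A harmonious coloring of a finite graph is a proper vertex coloring such that every pair of colors appears on at most one edge; $h(\mathcal L)$ is the minimum number of colors in a harmonious coloring of $\mathcal L$. -}

module Defs where

open import Data.Nat using (ℕ; _≤_; _*_; _+_)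
open import Data.Bool using (Bool; _∧_)
open import Data.Fin using (Fin)
open import Data.Fin.Subset using (Subset; _∈_; ∣_∣)
open import Data.Vec using (lookup; tabulate)
open import Data.Sum using (_⊎_; inj₁; inj₂)
open import Data.Product using (_×_)
open import Relation.Binary.PropositionalEquality using (_≡_; _≢_)

-- A (v,k,λ) design: points Fin v, blocks indexed by Fin b (repeated blocks allowed),
-- each block a k-subset of the points, every pair of distinct points in exactly λ blocks.
record Design (v k lam : ℕ) : Set where
  field
    b      : ℕ
    block  : Fin b → Subset v
    blockSize : ∀ j → ∣ block j ∣ ≡ k
    v≥k    : k ≤ v
    k≥3    : 3 ≤ k
    balanced : ∀ (x y : Fin v) → x ≢ y →
      ∣ tabulate (λ j → lookup (block j) x ∧ lookup (block j) y) ∣ ≡ lam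

open Design public

replication : ∀ {v k lam} → Design v k lam → Fin v → ℕ
replication D x = ∣ tabulate (λ j → lookup (block D j) x) ∣

LeviVertex : ∀ {v k lam} → Design v k lam → Set
LeviVertex {v} D = Fin v ⊎ Fin (b D)

data LeviAdj {v k lam} (D : Design v k lam) : LeviVertex D → LeviVertex D → Set where
  pt-blk : ∀ {x j} → x ∈ block D j → LeviAdj D (inj₁ x) (inj₂ j)
  blk-pt : ∀ {x j} → x ∈ block D j → LeviAdj D (inj₂ j) (inj₁ x)

-- harmonious coloring of a graph (V, E) with E symmetric, using colours Fin n:
-- proper, and two edges whose colour pairs coincide are the same edge.
record IsHarmonious {V : Set} (E : V → V → Set) {n : ℕ} (col : V → Fin n) : Set where
  field
    proper : ∀ {u w} → E u w → col u ≢ col w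
    harmonious : ∀ {u w u' w'} → E u w → E u' w' →
      col u ≡ col u' → col w ≡ col w' →
      (u ≡ u' × w ≡ w') ⊎ (u ≡ w' × w ≡ u')

{-# OPTIONS --safe #-}
-- Points receive pairwise distinct colours (any two lie in a common block), and so
-- do the r blocks through any point. Call y an out-neighbour of x when some block
-- through x has the colour of y; harmoniousness makes this relation asymmetric, so
-- some point x has out-degree t with 2t < v. At x, the v point colours together
-- with the colours of the blocks through x that are not point colours are
-- distinct, and the remaining blocks through x inject into the out-neighbours of
-- x; hence v + r ≤ t + n, and doubling gives the bound.
module Submission where

open import Defs
open import Data.Nat using (ℕ; _≤_; _*_; _+_)
open import Data.Fin using (Fin)
open import Relation.Binary.PropositionalEquality using (_≡_)

open import Data.Nat using (zero; suc; _<_; z≤n; s≤s; NonZero; >-nonZero; _≤?_)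
open import Data.Nat.Properties
  using (+-suc; +-mono-≤; +-mono-<-≤; +-monoʳ-≤; *-monoʳ-≤; +-cancelʳ-≤; m+[n∸m]≡n;
         ≤-trans; ≤-<-trans; <⇒≤; <⇒≱; ≰⇒>; +-identityʳ;
         +-0-commutativeMonoid; +-commutativeSemigroup; module ≤-Reasoning)
open import Data.Nat.Solver using (module +-*-Solver)
open import Algebra.Properties.CommutativeSemigroup +-commutativeSemigroup using (x∙yz≈y∙xz)
open import Data.Bool using (Bool; true; false; _∧_)
open import Data.Bool.Properties using (∧-conicalˡ; ∧-conicalʳ)
open import Data.Fin using (zero; suc; _≟_)
open import Data.Fin.Properties using (any?; ¬∀⟶∃¬; suc-injective; 0≢1+n)
open import Data.Fin.Subset
  using (Subset; inside; outside; _∈_; _∉_; ∣_∣; ⊤; ∁; _∩_; _∪_; _-_; Nonempty; Empty)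
open import Data.Fin.Subset.Properties
  using (_∈?_; ∣⊤∣≡n; ∣p∣≤n; ∣∁p∣≡n∸∣p∣; drop-∷-Empty; ∈⊤; ⊆⊤; p⊂q⇒∣p∣<∣q∣;
         x∈p⇒∣p-x∣<∣p∣; x∈p∧x≢y⇒x∈p-y; x∈p∩q⁻; x∈p∪q⁻; x∉p⇒x∈∁p; x∈∁p⇒x∉p)
open import Data.Vec using ([]; _∷_; lookup; tabulate; here; there)
open import Data.Vec.Properties using (lookup∘tabulate; []=⇒lookup; lookup⇒[]=)
open import Data.Sum using (inj₁; inj₂; [_,_])
open import Data.Sum.Properties using (inj₁-injective; inj₂-injective)
open import Data.Product using (_×_; _,_; proj₁; ∃-syntax; map; map₂)
open import Function using (_∘_)
open import Relation.Nullary using (Dec; yes; no; does; contradiction)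
open import Relation.Nullary.Decidable using (_×-dec_; dec-true; decidable-stable)
open import Relation.Unary using (Decidable)
open import Relation.Binary.PropositionalEquality using (refl; sym; trans; cong; subst)
open import Algebra.Properties.CommutativeMonoid.Sum +-0-commutativeMonoid
  using (sum; ∑-comm; ∑-distrib-+; sum-cong-≗)

private
  variable
    m n : ℕ

module _ {f : Fin n → Bool} {i : Fin n} where

  ∈-tabulate⁺ : f i ≡ true → i ∈ tabulate f
  ∈-tabulate⁺ fi = lookup⇒[]= i (tabulate f) (trans (lookup∘tabulate f i) fi)

  ∈-tabulate⁻ : i ∈ tabulate f → f i ≡ true
  ∈-tabulate⁻ i∈ = trans (sym (lookup∘tabulate f i)) ([]=⇒lookup i∈)

toSubset : {P : Fin n → Set} → Decidable P → Subset n
toSubset P? = tabulate (does ∘ P?)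

module _ {P : Fin n → Set} (P? : Decidable P) {i : Fin n} where

  ∈-toSubset⁺ : P i → i ∈ toSubset P?
  ∈-toSubset⁺ = ∈-tabulate⁺ ∘ dec-true (P? i)

  ∈-toSubset⁻ : i ∈ toSubset P? → P i
  ∈-toSubset⁻ i∈ with P? i | ∈-tabulate⁻ {f = does ∘ P?} i∈
  ... | yes Pi | _  = Pi
  ... | no  _  | ()

∣p∣>0⇒Nonempty : ∀ (p : Subset n) → 0 < ∣ p ∣ → Nonempty p
∣p∣>0⇒Nonempty (inside  ∷ p) _       = zero , here
∣p∣>0⇒Nonempty (outside ∷ p) 0<∣p∣ = map suc there (∣p∣>0⇒Nonempty p 0<∣p∣)

∣p∣≡∣p∩q∣+∣p∩∁q∣ : ∀ (p q : Subset n) → ∣ p ∣ ≡ ∣ p ∩ q ∣ + ∣ p ∩ ∁ q ∣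
∣p∣≡∣p∩q∣+∣p∩∁q∣ []            []            = refl
∣p∣≡∣p∩q∣+∣p∩∁q∣ (inside  ∷ p) (inside  ∷ q) = cong suc (∣p∣≡∣p∩q∣+∣p∩∁q∣ p q)
∣p∣≡∣p∩q∣+∣p∩∁q∣ (inside  ∷ p) (outside ∷ q) =
  trans (cong suc (∣p∣≡∣p∩q∣+∣p∩∁q∣ p q)) (sym (+-suc _ _))
∣p∣≡∣p∩q∣+∣p∩∁q∣ (outside ∷ p) (_       ∷ q) = ∣p∣≡∣p∩q∣+∣p∩∁q∣ p q

∣p∪q∣≡∣p∣+∣q∣ : ∀ (p q : Subset n) → Empty (p ∩ q) → ∣ p ∪ q ∣ ≡ ∣ p ∣ + ∣ q ∣
∣p∪q∣≡∣p∣+∣q∣ []            []            _ = refl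
∣p∪q∣≡∣p∣+∣q∣ (inside  ∷ p) (inside  ∷ q) e = contradiction (zero , here) e
∣p∪q∣≡∣p∣+∣q∣ (inside  ∷ p) (outside ∷ q) e = cong suc (∣p∪q∣≡∣p∣+∣q∣ p q (drop-∷-Empty e))
∣p∪q∣≡∣p∣+∣q∣ (outside ∷ p) (inside  ∷ q) e =
  trans (cong suc (∣p∪q∣≡∣p∣+∣q∣ p q (drop-∷-Empty e))) (sym (+-suc _ _))
∣p∪q∣≡∣p∣+∣q∣ (outside ∷ p) (outside ∷ q) e = ∣p∪q∣≡∣p∣+∣q∣ p q (drop-∷-Empty e)

∣p∣+∣∁p∣≡n : ∀ (p : Subset n) → ∣ p ∣ + ∣ ∁ p ∣ ≡ n
∣p∣+∣∁p∣≡n p = trans (cong (∣ p ∣ +_) (∣∁p∣≡n∸∣p∣ p)) (m+[n∸m]≡n (∣p∣≤n p))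

injection⇒∣p∣≤∣q∣ : ∀ (p : Subset m) (q : Subset n) (R : Fin m → Fin n → Set) →
  (∀ {i} → i ∈ p → ∃[ c ] c ∈ q × R i c) →
  (∀ {i j c} → i ∈ p → j ∈ p → R i c → R j c → i ≡ j) →
  ∣ p ∣ ≤ ∣ q ∣
injection⇒∣p∣≤∣q∣ [] q R total inj = z≤n
injection⇒∣p∣≤∣q∣ (outside ∷ p) q R total inj =
  injection⇒∣p∣≤∣q∣ p q (R ∘ suc) (total ∘ there)
    (λ i∈p j∈p Ric Rjc → suc-injective (inj (there i∈p) (there j∈p) Ric Rjc))
injection⇒∣p∣≤∣q∣ (inside ∷ p) q R total inj with total here
... | c , c∈q , R0c =
  ≤-<-trans (injection⇒∣p∣≤∣q∣ p (q - c) (R ∘ suc) total-c inj-suc) (x∈p⇒∣p-x∣<∣p∣ c∈q)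
  where
  inj-suc : ∀ {i j d} → i ∈ p → j ∈ p → R (suc i) d → R (suc j) d → i ≡ j
  inj-suc i∈p j∈p Rid Rjd = suc-injective (inj (there i∈p) (there j∈p) Rid Rjd)

  total-c : ∀ {i} → i ∈ p → ∃[ d ] d ∈ q - c × R (suc i) d
  total-c i∈p with total (there i∈p)
  ... | d , d∈q , Rid =
    d , x∈p∧x≢y⇒x∈p-y d∈q (λ { refl → 0≢1+n (inj here (there i∈p) R0c Rid) }) , Rid

indicator : Bool → ℕ
indicator true  = 1
indicator false = 0

∣p∣≡∑indicator : ∀ (p : Subset n) → ∣ p ∣ ≡ sum (indicator ∘ lookup p)
∣p∣≡∑indicator []            = refl
∣p∣≡∑indicator (inside  ∷ p) = cong suc (∣p∣≡∑indicator p)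
∣p∣≡∑indicator (outside ∷ p) = ∣p∣≡∑indicator p

∑-mono-≤ : {f g : Fin n → ℕ} → (∀ i → f i ≤ g i) → sum f ≤ sum g
∑-mono-≤ {zero}  f≤g = z≤n
∑-mono-≤ {suc n} f≤g = +-mono-≤ (f≤g zero) (∑-mono-≤ (f≤g ∘ suc))

∑-mono-< : .{{NonZero n}} → {f g : Fin n → ℕ} → (∀ i → f i < g i) → sum f < sum g
∑-mono-< {suc n} f<g = +-mono-<-≤ (f<g zero) (∑-mono-≤ (λ i → <⇒≤ (f<g (suc i))))

∑<∑⇒∃< : (f g : Fin n → ℕ) → sum f < sum g → ∃[ i ] f i < g i
∑<∑⇒∃< {n} f g ∑f<∑g =
  map₂ ≰⇒> (¬∀⟶∃¬ n (λ i → g i ≤ f i) (λ i → g i ≤? f i) (<⇒≱ ∑f<∑g ∘ ∑-mono-≤))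

-- Out- and in-degrees have the same total, and at each vertex they add up to less than n.
∃-outdegree-below-half : .{{NonZero n}} → (out : Fin n → Subset n) →
  (∀ {x y} → y ∈ out x → x ∉ out y) → ∃[ x ] 2 * ∣ out x ∣ < n
∃-outdegree-below-half {n} out asym = ∑<∑⇒∃< (λ x → 2 * ∣ out x ∣) (λ (_ : Fin n) → n) (begin-strict
    sum (λ x → 2 * ∣ out x ∣)             ≡⟨ sum-cong-≗ (λ x → cong (∣ out x ∣ +_) (+-identityʳ _)) ⟩
    sum (λ x → ∣ out x ∣ + ∣ out x ∣)     ≡⟨ ∑-distrib-+ (∣_∣ ∘ out) (∣_∣ ∘ out) ⟩
    sum (∣_∣ ∘ out) + sum (∣_∣ ∘ out)     ≡⟨ cong (sum (∣_∣ ∘ out) +_) ∑out≡∑in ⟩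
    sum (∣_∣ ∘ out) + sum (∣_∣ ∘ in′)     ≡⟨ ∑-distrib-+ (∣_∣ ∘ out) (∣_∣ ∘ in′) ⟨
    sum (λ x → ∣ out x ∣ + ∣ in′ x ∣)     <⟨ ∑-mono-< out+in<n ⟩
    sum (λ (_ : Fin n) → n)               ∎)
  where
  open ≤-Reasoning

  in′ : Fin n → Subset n
  in′ y = tabulate (λ x → lookup (out x) y)

  ∑out≡∑in : sum (∣_∣ ∘ out) ≡ sum (∣_∣ ∘ in′)
  ∑out≡∑in = begin-equality
    sum (∣_∣ ∘ out)                         ≡⟨ sum-cong-≗ (∣p∣≡∑indicator ∘ out) ⟩
    sum (λ x → sum (λ y → 𝟙 x y))           ≡⟨ ∑-comm 𝟙 ⟩
    sum (λ y → sum (λ x → 𝟙 x y))           ≡⟨ sum-cong-≗ (λ y → sum-cong-≗ (λ x →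
                                                 cong indicator (lookup∘tabulate (λ x → lookup (out x) y) x))) ⟨
    sum (λ y → sum (indicator ∘ lookup (in′ y))) ≡⟨ sum-cong-≗ (∣p∣≡∑indicator ∘ in′) ⟨
    sum (∣_∣ ∘ in′)                         ∎
    where
    𝟙 : Fin n → Fin n → ℕ
    𝟙 x y = indicator (lookup (out x) y)

  ∈in′⁻ : ∀ {x y} → x ∈ in′ y → y ∈ out x
  ∈in′⁻ {x} {y} x∈ = lookup⇒[]= y (out x) (∈-tabulate⁻ x∈)

  out+in<n : ∀ x → ∣ out x ∣ + ∣ in′ x ∣ < n
  out+in<n x = begin-strict
    ∣ out x ∣ + ∣ in′ x ∣  ≡⟨ ∣p∪q∣≡∣p∣+∣q∣ (out x) (in′ x) disjoint ⟨
    ∣ out x ∪ in′ x ∣       <⟨ p⊂q⇒∣p∣<∣q∣ (⊆⊤ , x , ∈⊤ , x∉) ⟩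
    ∣ ⊤ {n} ∣               ≡⟨ ∣⊤∣≡n n ⟩
    n                       ∎
    where
    disjoint : Empty (out x ∩ in′ x)
    disjoint (y , y∈) with x∈p∩q⁻ (out x) (in′ x) y∈
    ... | y∈out , y∈in = asym y∈out (∈in′⁻ y∈in)

    x∉out : x ∉ out x
    x∉out x∈out = asym x∈out x∈out

    x∉ : x ∉ out x ∪ in′ x
    x∉ = [ x∉out , x∉out ∘ ∈in′⁻ ] ∘ x∈p∪q⁻ (out x) (in′ x)

module LeviColouring {v k lam} (D : Design v k lam) {n} {col : LeviVertex D → Fin n}
                     (harm : IsHarmonious (LeviAdj D) col) where

  open IsHarmonious harm

  pointColour : Fin v → Fin n
  pointColour x = col (inj₁ x)

  blockColour : Fin (b D) → Fin n
  blockColour j = col (inj₂ j)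

  blockColour-injectiveAt : ∀ {x j j′} → x ∈ block D j → x ∈ block D j′ →
    blockColour j ≡ blockColour j′ → j ≡ j′
  blockColour-injectiveAt x∈j x∈j′ same with harmonious (blk-pt x∈j) (blk-pt x∈j′) same refl
  ... | inj₁ (j≡j′ , _) = inj₂-injective j≡j′
  ... | inj₂ (() , _)

  pointColour-injectiveOn : ∀ {x y j} → x ∈ block D j → y ∈ block D j →
    pointColour x ≡ pointColour y → x ≡ y
  pointColour-injectiveOn x∈j y∈j same with harmonious (pt-blk x∈j) (pt-blk y∈j) same refl
  ... | inj₁ (x≡y , _) = inj₁-injective x≡y
  ... | inj₂ (() , _)

  -- Since λ ≥ 1, two distinct points lie in a common block.
  pointColour-injective : 1 ≤ lam → ∀ {x y} → pointColour x ≡ pointColour y → x ≡ y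
  pointColour-injective 1≤λ {x} {y} same = decidable-stable (x ≟ y) λ x≢y →
    let common = tabulate (λ j → lookup (block D j) x ∧ lookup (block D j) y)
        j , j∈ = ∣p∣>0⇒Nonempty common (subst (0 <_) (sym (balanced D x y x≢y)) 1≤λ)
        x∧y = ∈-tabulate⁻ j∈
    in x≢y (pointColour-injectiveOn (lookup⇒[]= x _ (∧-conicalˡ _ _ x∧y))
                                    (lookup⇒[]= y _ (∧-conicalʳ _ _ x∧y)) same)

  _⇝_ : Fin v → Fin v → Set
  x ⇝ y = ∃[ j ] x ∈ block D j × blockColour j ≡ pointColour y

  _⇝?_ : ∀ x y → Dec (x ⇝ y)
  x ⇝? y = any? (λ j → (x ∈? block D j) ×-dec (blockColour j ≟ pointColour y))

  outNeighbours : Fin v → Subset v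
  outNeighbours x = toSubset (x ⇝?_)

  -- A block through x coloured like y and a block through y coloured like x would
  -- give the edges x–j and j′–y the same colour pair.
  outNeighbours-asym : ∀ {x y} → y ∈ outNeighbours x → x ∉ outNeighbours y
  outNeighbours-asym {x} {y} y∈ x∈
    with ∈-toSubset⁻ (x ⇝?_) y∈ | ∈-toSubset⁻ (y ⇝?_) x∈
  ... | j , x∈j , cj≡cy | j′ , y∈j′ , cj′≡cx
    with harmonious (pt-blk x∈j) (blk-pt y∈j′) (sym cj′≡cx) cj≡cy
  ... | inj₁ (() , _)
  ... | inj₂ (x≡y , _) = proper (pt-blk x∈j) (trans (cong col x≡y) (sym cj≡cy))

  isPointColour? : Decidable (λ c → ∃[ y ] pointColour y ≡ c)
  isPointColour? c = any? (λ y → pointColour y ≟ c)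

  pointColours : Subset n
  pointColours = toSubset isPointColour?

  v≤∣pointColours∣ : 1 ≤ lam → v ≤ ∣ pointColours ∣
  v≤∣pointColours∣ 1≤λ = subst (_≤ ∣ pointColours ∣) (∣⊤∣≡n v)
    (injection⇒∣p∣≤∣q∣ ⊤ pointColours (λ y c → pointColour y ≡ c)
      (λ {y} _ → pointColour y , ∈-toSubset⁺ isPointColour? (y , refl) , refl)
      (λ _ _ cx≡c cy≡c → pointColour-injective 1≤λ (trans cx≡c (sym cy≡c))))

  -- The blocks through x split by whether their colour is also a point colour:
  -- the first kind inject into the out-neighbours of x, the second into the
  -- colours used on no point.
  replication≤∣out∣+∣∁pointColours∣ : ∀ x →
    replication D x ≤ ∣ outNeighbours x ∣ + ∣ ∁ pointColours ∣
  replication≤∣out∣+∣∁pointColours∣ x = begin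
    replication D x                                        ≡⟨ ∣p∣≡∣p∩q∣+∣p∩∁q∣ through pointColoured ⟩
    ∣ through ∩ pointColoured ∣ + ∣ through ∩ ∁ pointColoured ∣
      ≤⟨ +-mono-≤ (injection⇒∣p∣≤∣q∣ _ (outNeighbours x) (λ j y → blockColour j ≡ pointColour y)
                                     toOut injective)
                  (injection⇒∣p∣≤∣q∣ _ (∁ pointColours) (λ j c → blockColour j ≡ c) toUnused injective) ⟩
    ∣ outNeighbours x ∣ + ∣ ∁ pointColours ∣               ∎
    where
    open ≤-Reasoning

    through : Subset (b D)
    through = tabulate (λ j → lookup (block D j) x)

    pointColoured? : Decidable (λ j → blockColour j ∈ pointColours)
    pointColoured? j = blockColour j ∈? pointColours

    pointColoured : Subset (b D)
    pointColoured = toSubset pointColoured?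

    x∈ : ∀ {j} → j ∈ through → x ∈ block D j
    x∈ j∈ = lookup⇒[]= x _ (∈-tabulate⁻ j∈)

    x∈∩ : ∀ {q j} → j ∈ through ∩ q → x ∈ block D j
    x∈∩ {q} j∈ = x∈ (proj₁ (x∈p∩q⁻ through q j∈))

    injective : ∀ {q j j′ c} → j ∈ through ∩ q → j′ ∈ through ∩ q →
      blockColour j ≡ c → blockColour j′ ≡ c → j ≡ j′
    injective j∈ j′∈ cj≡c cj′≡c = blockColour-injectiveAt (x∈∩ j∈) (x∈∩ j′∈) (trans cj≡c (sym cj′≡c))

    toOut : ∀ {j} → j ∈ through ∩ pointColoured →
      ∃[ y ] y ∈ outNeighbours x × blockColour j ≡ pointColour y
    toOut {j} j∈ with x∈p∩q⁻ through pointColoured j∈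
    ... | j∈through , j∈pc with ∈-toSubset⁻ isPointColour? (∈-toSubset⁻ pointColoured? j∈pc)
    ... | y , cy≡cj = y , ∈-toSubset⁺ (x ⇝?_) (j , x∈ j∈through , sym cy≡cj) , sym cy≡cj

    toUnused : ∀ {j} → j ∈ through ∩ ∁ pointColoured →
      ∃[ c ] c ∈ ∁ pointColours × blockColour j ≡ c
    toUnused {j} j∈ with x∈p∩q⁻ through (∁ pointColoured) j∈
    ... | _ , j∉pc = blockColour j , x∉p⇒x∈∁p (x∈∁p⇒x∉p j∉pc ∘ ∈-toSubset⁺ pointColoured?) , refl

  v+replication≤∣out∣+n : 1 ≤ lam → ∀ x → v + replication D x ≤ ∣ outNeighbours x ∣ + n
  v+replication≤∣out∣+n 1≤λ x = begin
    v + replication D x                            ≤⟨ +-mono-≤ (v≤∣pointColours∣ 1≤λ)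
                                                               (replication≤∣out∣+∣∁pointColours∣ x) ⟩
    ∣ pointColours ∣ + (∣ out ∣ + ∣ ∁ pointColours ∣)
      ≡⟨ x∙yz≈y∙xz (∣ pointColours ∣) (∣ out ∣) (∣ ∁ pointColours ∣) ⟩
    ∣ out ∣ + (∣ pointColours ∣ + ∣ ∁ pointColours ∣) ≡⟨ cong (∣ out ∣ +_) (∣p∣+∣∁p∣≡n pointColours) ⟩
    ∣ out ∣ + n                                    ∎
    where
    open ≤-Reasoning
    out = outNeighbours x

double-and-add : ∀ {v r n t} → v + r ≤ t + n → 2 * t < v → 2 * r + (v + 1) ≤ 2 * n
double-and-add {v} {r} {n} {t} v+r≤t+n 2t<v = +-cancelʳ-≤ (2 * t) (2 * r + (v + 1)) (2 * n) (begin
  2 * r + (v + 1) + 2 * t ≡⟨ solve 3 (λ r v t → con 2 :* r :+ (v :+ con 1) :+ con 2 :* t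
                                     := con 2 :* r :+ v :+ (con 1 :+ con 2 :* t)) refl r v t ⟩
  2 * r + v + suc (2 * t) ≤⟨ +-monoʳ-≤ (2 * r + v) 2t<v ⟩
  2 * r + v + v           ≡⟨ solve 2 (λ r v → con 2 :* r :+ v :+ v := con 2 :* (v :+ r)) refl r v ⟩
  2 * (v + r)             ≤⟨ *-monoʳ-≤ 2 v+r≤t+n ⟩
  2 * (t + n)             ≡⟨ solve 2 (λ t n → con 2 :* (t :+ n) := con 2 :* n :+ con 2 :* t) refl t n ⟩
  2 * n + 2 * t           ∎)
  where
  open ≤-Reasoning
  open +-*-Solver

mainTheorem10 : ∀ {v k lam r : ℕ} (D : Design v k lam) → 1 ≤ lam →
    (∀ x → replication D x ≡ r) →
    ∀ (n : ℕ) (col : LeviVertex D → Fin n) → IsHarmonious (LeviAdj D) col →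
    2 * r + (v + 1) ≤ 2 * n
mainTheorem10 {v} D 1≤λ rep n col harm =
  let x , 2∣out∣<v = ∃-outdegree-below-half {{v≢0}} outNeighbours outNeighbours-asym
      v+r≤t+n = subst (λ r → v + r ≤ ∣ outNeighbours x ∣ + n) (rep x) (v+replication≤∣out∣+n 1≤λ x)
  in double-and-add {n = n} {t = ∣ outNeighbours x ∣} v+r≤t+n 2∣out∣<v
  where
  open LeviColouring D harm
  v≢0 : NonZero v
  v≢0 = >-nonZero (≤-trans (s≤s z≤n) (≤-trans (k≥3 D) (v≥k D)))
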